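{- Let $m\geq 1$ and let $\alpha=(\alpha_0,\dots,\alpha_{m-1})\in\mathbb{N}^m$ be not identically zero. Define $$u_\alpha(n)=\sum_{k\geq 0}\langle n,k\rangle^{\alpha_0}\langle n,k+1\rangle^{\alpha_1}\cdots\langle n,k+m-1\rangle^{\alpha_{m-1}},$$ with the convention $0^0=1$. Then $u_\alpha(n)$ has a rational generating function. That is, there exist complex numbers $c_1,\dots,c_\ell$ with $c_\ell\neq 0$ and an integer $n_0$ such that $$u_\alpha(n+\ell)+c_1u_\alpha(n+\ell-1)+\cdots+c_\ell u_\alpha(n)=0\quad\text{for all } n\geq n_0.$$ Equivalently, $\sum_{n\geq 0}u_\alpha(n)x^n=P(x)/Q(x)$ for some polynomials $P,Q\in\mathbb{C}[x]$ with $Q(0)\neq 0$.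
   Context: Here $\mathbb{N}=\{0,1,2,\dots\}$. Stern's triangle is the array of integers $\langle n,k\rangle$ ($n\geq 0$, $k\in\mathbb{Z}$) defined as follows. Row $0$ consists of a single entry, $\langle 0,0\rangle=1$. For $n\geq 0$, row $n$ has entries $\langle n,k\rangle$ for $0\leq k\leq 2^{n+1}-2$, and $\langle n,k\rangle=0$ whenever $k<0$ or $k>2^{n+1}-2$. Row $n+1$ is obtained from row $n$ by $$\langle n+1,2k+1\rangle=\langle n,k\rangle,\qquad \langle n+1,2k\rangle=\langle n,k-1\rangle+\langle n,k\rangle\qquad(k\in\mathbb{Z}).$$ -}

module Defs where

open import Data.Nat using (ℕ; zero; suc; _+_; _*_; _^_; _%_; _/_)
open import Data.Fin using (Fin; toℕ)
open import Data.List using (List; map; upTo; allFin; foldr)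
open import Data.Nat.ListAction using (sum; product)
open import Data.Integer using (+_)
import Data.Rational as ℚ
open ℚ using (ℚ)

-- Stern's triangle: stern n k = ⟨n,k⟩ for k ≥ 0 (entries with k < 0 are 0 and
-- never needed, since u_α only uses indices k ≥ 0).
mutual
  stern : ℕ → ℕ → ℕ
  stern zero zero = 1
  stern zero (suc _) = 0
  stern (suc n) k with k % 2
  ... | zero = sternEven n (k / 2)
  ... | suc _ = stern n (k / 2)

  -- sternEven n h = ⟨n+1,2h⟩ = ⟨n,h-1⟩ + ⟨n,h⟩  (with ⟨n,-1⟩ = 0)
  sternEven : ℕ → ℕ → ℕ
  sternEven n zero = stern n zero
  sternEven n (suc h) = stern n h + stern n (suc h)

-- the k-th summand  ⟨n,k⟩^{α_0} ⋯ ⟨n,k+m-1⟩^{α_{m-1}}  (ℕ's _^_ has 0^0 = 1)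
term : (m : ℕ) → (Fin m → ℕ) → ℕ → ℕ → ℕ
term m α n k = product (map (λ i → stern n (k + toℕ i) ^ α i) (allFin m))

-- u_α(n) = Σ_{k ≥ 0} term; for α not identically zero every summand with
-- k ≥ 2^{n+1} vanishes (row n is zero beyond index 2^{n+1}-2), so the sum is
-- taken over 0 ≤ k < 2^{n+1}.
u : (m : ℕ) → (Fin m → ℕ) → ℕ → ℕ
u m α n = sum (map (term m α n) (upTo (2 ^ suc n)))

toℚ : ℕ → ℚ
toℚ x = + x ℚ./ 1

-- Σ_{j=1}^{ℓ} c_j · s(n+ℓ-j), with c : Fin ℓ → ℚ, c i = c_{i+1}
recSum : (ℓ : ℕ) → (Fin ℓ → ℚ) → (ℕ → ℚ) → ℕ → ℚ
recSum ℓ c s n = foldr ℚ._+_ ℚ.0ℚ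
  (map (λ i → c i ℚ.* s (n + ℓ Data.Nat.∸ suc (toℕ i))) (allFin ℓ))

module Submission where

-- Write a(n, k) = ⟨n, k − 1⟩ and, for a vector o = (e₁, …, e_D) of offsets in {0, …, W − 1},
-- S_n(o) = Σ_{k < 2^{n+1}} Π_i a(n, k + e_i); then u_α(n) = S_n(o_α), where o_α lists i + 1 with
-- multiplicity α_i. Writing k = 2k′ + j with j ∈ {0, 1}, Stern's recurrence turns each factor
-- a(n + 1, 2k′ + j + e_i) into a sum of one or two factors a(n, k′ + e′) with e′ again in {0, …, W − 1};
-- expanding the product gives S_{n+1}(o) = Σ S_n(o′) over a finite list of successor windows o′. So the
-- finitely many sequences S(o) obey one linear system with constant coefficients: the N + 1 vectors
-- S_0, …, S_N ∈ ℚ^N (N windows) are linearly dependent, and the step propagates the dependence to all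
-- shifts. Dropping vanishing extreme coefficients and dividing by the leading one turns this relation
-- into the recurrence for u_α.

module RationalRecurrence where
  open import Defs using (toℚ; recSum)
  open import Data.Nat as ℕ using (ℕ; zero; suc; _≤_; _<_; s≤s)
  import Data.Nat.Properties as ℕ
  open import Data.Nat.ListAction using () renaming (sum to sumℕ)
  import Data.Nat.Coprimality as Coprimality
  import Data.Integer as ℤ
  import Data.Integer.Properties as ℤ
  open import Data.Rational using (ℚ; mkℚ; 0ℚ; 1ℚ; _+_; _*_; _-_; -_; 1/_; _/_; ≢-nonZero)
  open import Data.Rational.Properties
    using (_≟_; +-*-commutativeRing; 1≢0; *-zeroʳ; *-zeroˡ; *-identityˡ; *-assoc; *-inverseˡ
          ; +-identityˡ; +-identityʳ; normalize-coprime)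
  open import Data.Rational.Solver using (module +-*-Solver)
  open +-*-Solver using (solve; _:=_; _:+_; _:*_; _:-_; :-_; con)
  open import Algebra.Bundles using (CommutativeRing)
  open import Algebra.Properties.Semiring.Sum (CommutativeRing.semiring +-*-commutativeRing)
    using (sum-syntax; sum-cong-≗; ∑-distrib-+; ∑-comm; sum-replicate-zero; sum-remove; sum-init-last; *-distribˡ-sum; ∑-permute)
  open import Data.Fin using (Fin; zero; suc; toℕ; fromℕ; inject₁; opposite; punchIn)
  open import Data.Fin.Properties using (any?; toℕ-inject₁; toℕ-fromℕ; toℕ<n; opposite-prop)
  open import Data.Fin.Permutation using (reverse)
  open import Data.Vec.Functional using (insertAt)
  open import Data.Vec.Functional.Properties using (insertAt-lookup; insertAt-punchIn)
  open import Data.List using (List; []; _∷_; map; length; lookup; tabulate; allFin; foldr)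
  open import Data.List.Properties using (map-tabulate)
  open import Data.List.Membership.Propositional using (_∈_)
  open import Data.List.Relation.Unary.Any using (index)
  open import Data.List.Relation.Unary.Any.Properties using (lookup-index)
  open import Data.Product using (Σ; ∃; _×_; _,_; proj₁; proj₂)
  open import Relation.Nullary using (yes; no; ¬?)
  open import Relation.Nullary.Decidable using (decidable-stable)
  open import Function using (_∘_)
  open import Relation.Binary.PropositionalEquality
  open ≡-Reasoning

  toℚ≡mkℚ : ∀ a → toℚ a ≡ mkℚ (ℤ.+ a) 0 (Coprimality.sym (Coprimality.1-coprimeTo a))
  toℚ≡mkℚ a = normalize-coprime (Coprimality.sym (Coprimality.1-coprimeTo a))

  toℚ-+ : ∀ a b → toℚ (a ℕ.+ b) ≡ toℚ a + toℚ b
  toℚ-+ a b = sym (begin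
    toℚ a + toℚ b
      ≡⟨ cong₂ _+_ (toℚ≡mkℚ a) (toℚ≡mkℚ b) ⟩
    (ℤ.+ a ℤ.* ℤ.+ 1 ℤ.+ ℤ.+ b ℤ.* ℤ.+ 1) / 1
      ≡⟨ cong₂ (λ x y → (x ℤ.+ y) / 1) (ℤ.*-identityʳ (ℤ.+ a)) (ℤ.*-identityʳ (ℤ.+ b)) ⟩
    toℚ (a ℕ.+ b) ∎)

  toℚ-sum : ∀ {A : Set} (f : A → ℕ) xs → toℚ (sumℕ (map f xs)) ≡ ∑[ i < length xs ] toℚ (f (lookup xs i))
  toℚ-sum f [] = refl
  toℚ-sum f (x ∷ xs) = trans (toℚ-+ (f x) _) (cong (toℚ (f x) +_) (toℚ-sum f xs))

  *-≢0 : ∀ {p q} → p ≢ 0ℚ → q ≢ 0ℚ → p * q ≢ 0ℚ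
  *-≢0 {p} {q} p≢0 q≢0 pq≡0 = q≢0 (begin
    q              ≡⟨ sym (*-identityˡ q) ⟩
    1ℚ * q         ≡⟨ cong (_* q) (sym (*-inverseˡ p)) ⟩
    1/ p * p * q   ≡⟨ *-assoc (1/ p) p q ⟩
    1/ p * (p * q) ≡⟨ cong (1/ p *_) pq≡0 ⟩
    1/ p * 0ℚ      ≡⟨ *-zeroʳ (1/ p) ⟩
    0ℚ ∎)
    where instance _ = ≢-nonZero p≢0

  1/-≢0 : ∀ {p} (p≢0 : p ≢ 0ℚ) → (1/ p) {{≢-nonZero p≢0}} ≢ 0ℚ
  1/-≢0 {p} p≢0 1/p≡0 = 1≢0 (begin
    1ℚ       ≡⟨ sym (*-inverseˡ p) ⟩
    1/ p * p ≡⟨ cong (_* p) 1/p≡0 ⟩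
    0ℚ * p   ≡⟨ *-zeroˡ p ⟩
    0ℚ ∎)
    where instance _ = ≢-nonZero p≢0

  Nontrivial : ∀ {K} → (Fin K → ℚ) → Set
  Nontrivial c = ∃ λ t → c t ≢ 0ℚ

  ∑-insertAt : ∀ {K} (c : Fin K → ℚ) t₀ x (v : Fin (suc K) → ℚ) →
    ∑[ t < suc K ] (insertAt c t₀ x t * v t) ≡ x * v t₀ + ∑[ j < K ] (c j * v (punchIn t₀ j))
  ∑-insertAt c t₀ x v = trans (sum-remove {i = t₀} (λ t → insertAt c t₀ x t * v t))
    (cong₂ _+_ (cong (_* v t₀) (insertAt-lookup c t₀ x))
               (sum-cong-≗ (λ j → cong (_* v (punchIn t₀ j)) (insertAt-punchIn c t₀ x j))))

  Dependence : ∀ {K N} → (Fin K → Fin N → ℚ) → Set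
  Dependence {K} v = Σ (Fin K → ℚ) λ c → Nontrivial c × (∀ i → ∑[ t < K ] (c t * v t i) ≡ 0ℚ)

  dependence-zeroColumn : ∀ {K N} (v : Fin K → Fin (suc N) → ℚ) → (∀ t → v t zero ≡ 0ℚ) →
    Dependence (λ t i → v t (suc i)) → Dependence v
  dependence-zeroColumn {K} v v₀≡0 (c , nontrivial , rest) = c , nontrivial , column
    where
    column : ∀ i → ∑[ t < K ] (c t * v t i) ≡ 0ℚ
    column zero = trans (sum-cong-≗ (λ t → trans (cong (c t *_) (v₀≡0 t)) (*-zeroʳ (c t)))) (sum-replicate-zero K)
    column (suc i) = rest i

  -- Fraction-free elimination of column 0 with the pivot row t₀.
  eliminate : ∀ {K N} → (Fin (suc K) → Fin (suc N) → ℚ) → Fin (suc K) → Fin K → Fin N → ℚ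
  eliminate v t₀ j i = v t₀ zero * v (punchIn t₀ j) (suc i) - v (punchIn t₀ j) zero * v t₀ (suc i)

  dependence-pivot : ∀ {K N} (v : Fin (suc K) → Fin (suc N) → ℚ) t₀ → v t₀ zero ≢ 0ℚ →
    Dependence (eliminate v t₀) → Dependence v
  dependence-pivot {K} v t₀ p≢0 (b , (s , bs≢0) , b-kills) = c , (punchIn t₀ s , c-nontrivial) , column
    where
    p = v t₀ zero
    row = v ∘ punchIn t₀
    B₀ = ∑[ j < K ] (b j * row j zero)
    c = insertAt (λ j → p * b j) t₀ (- B₀)

    c-nontrivial : c (punchIn t₀ s) ≢ 0ℚ
    c-nontrivial rewrite insertAt-punchIn (λ j → p * b j) t₀ (- B₀) s = *-≢0 p≢0 bs≢0

    split : ∀ i → ∑[ t < suc K ] (c t * v t i) ≡ - B₀ * v t₀ i + p * ∑[ j < K ] (b j * row j i)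
    split i = trans (∑-insertAt _ t₀ (- B₀) (λ t → v t i))
      (cong (- B₀ * v t₀ i +_) (trans (sum-cong-≗ (λ j → *-assoc p (b j) (row j i)))
                                       (sym (*-distribˡ-sum p (λ j → b j * row j i)))))

    eliminated : ∀ i → ∑[ j < K ] (b j * eliminate v t₀ j i) ≡ - B₀ * v t₀ (suc i) + p * ∑[ j < K ] (b j * row j (suc i))
    eliminated i = begin
      ∑[ j < K ] (b j * eliminate v t₀ j i)
        ≡⟨ sum-cong-≗ (λ j → solve 5 (λ b p x y z → b :* (p :* x :- y :* z) := p :* (b :* x) :+ (:- z) :* (b :* y))
                                       refl (b j) p (row j (suc i)) (row j zero) z) ⟩
      ∑[ j < K ] (p * (b j * row j (suc i)) + (- z) * (b j * row j zero))
        ≡⟨ ∑-distrib-+ (λ j → p * (b j * row j (suc i))) (λ j → (- z) * (b j * row j zero)) ⟩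
      ∑[ j < K ] (p * (b j * row j (suc i))) + ∑[ j < K ] ((- z) * (b j * row j zero))
        ≡⟨ sym (cong₂ _+_ (*-distribˡ-sum p (λ j → b j * row j (suc i))) (*-distribˡ-sum (- z) (λ j → b j * row j zero))) ⟩
      p * X + (- z) * B₀
        ≡⟨ solve 3 (λ X z B → X :+ (:- z) :* B := :- B :* z :+ X) refl (p * X) z B₀ ⟩
      - B₀ * z + p * X ∎
      where
      z = v t₀ (suc i)
      X = ∑[ j < K ] (b j * row j (suc i))

    column : ∀ i → ∑[ t < suc K ] (c t * v t i) ≡ 0ℚ
    column zero = trans (split zero) (solve 2 (λ B p → :- B :* p :+ p :* B := con 0ℚ) refl B₀ p)
    column (suc i) = trans (split (suc i)) (trans (sym (eliminated i)) (b-kills i))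

  linearlyDependent : ∀ {K N} → N < K → (v : Fin K → Fin N → ℚ) → Dependence v
  linearlyDependent {suc K} {zero} _ v = (λ _ → 1ℚ) , (zero , 1≢0) , λ ()
  linearlyDependent {suc K} {suc N} (s≤s N<K) v with any? (λ t → ¬? (v t zero ≟ 0ℚ))
  ... | yes (t₀ , p≢0) = dependence-pivot v t₀ p≢0 (linearlyDependent N<K (eliminate v t₀))
  ... | no noPivot = dependence-zeroColumn v (λ t → decidable-stable (v t zero ≟ 0ℚ) (λ p≢0 → noPivot (t , p≢0)))
                       (linearlyDependent (ℕ.m<n⇒m<1+n N<K) (λ t i → v t (suc i)))

  record Annihilates {K} (c : Fin K → ℚ) (x : ℕ → ℚ) : Set where
    constructor annihilates
    field annihilates-at : ∀ n → ∑[ t < K ] (c t * x (n ℕ.+ toℕ t)) ≡ 0ℚ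

  annihilator : ∀ {I : Set} (states : List I) → (∀ s → s ∈ states) →
    (successors : I → List I) (S : ℕ → I → ℕ) → (∀ n s → S (suc n) s ≡ sumℕ (map (S n) (successors s))) →
    Σ ℕ λ K → Σ (Fin K → ℚ) λ c → Nontrivial c × (∀ s → Annihilates c (λ n → toℚ (S n s)))
  annihilator states complete successors S step = suc N , c , nontrivial , λ s → annihilates (vanishes s)
    where
    N = length states
    X : ℕ → _ → ℚ
    X n s = toℚ (S n s)
    dependence = linearlyDependent ℕ.≤-refl (λ t i → X (toℕ t) (lookup states i))
    c = proj₁ dependence
    nontrivial = proj₁ (proj₂ dependence)

    vanishes : ∀ s n → ∑[ t < suc N ] (c t * X (n ℕ.+ toℕ t) s) ≡ 0ℚ
    vanishes s zero = subst (λ s′ → ∑[ t < suc N ] (c t * X (toℕ t) s′) ≡ 0ℚ)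
      (sym (lookup-index (complete s))) (proj₂ (proj₂ dependence) (index (complete s)))
    vanishes s (suc n) = begin
      ∑[ t < suc N ] (c t * X (suc n ℕ.+ toℕ t) s)
        ≡⟨ sum-cong-≗ (λ t → cong (c t *_) (trans (cong toℚ (step (n ℕ.+ toℕ t) s))
                                                   (toℚ-sum (S (n ℕ.+ toℕ t)) (successors s)))) ⟩
      ∑[ t < suc N ] (c t * ∑[ i < k ] X (n ℕ.+ toℕ t) (next i))
        ≡⟨ sum-cong-≗ (λ t → *-distribˡ-sum (c t) (λ i → X (n ℕ.+ toℕ t) (next i))) ⟩
      ∑[ t < suc N ] ∑[ i < k ] (c t * X (n ℕ.+ toℕ t) (next i))
        ≡⟨ ∑-comm (λ t i → c t * X (n ℕ.+ toℕ t) (next i)) ⟩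
      ∑[ i < k ] ∑[ t < suc N ] (c t * X (n ℕ.+ toℕ t) (next i))
        ≡⟨ sum-cong-≗ (λ i → vanishes (next i) n) ⟩
      ∑[ i < k ] 0ℚ
        ≡⟨ sum-replicate-zero k ⟩
      0ℚ ∎
      where
      k = length (successors s)
      next = lookup (successors s)

  annihilates-cong : ∀ {K} {c : Fin K → ℚ} x y → Annihilates c x → (∀ n → x n ≡ y n) → Annihilates c y
  annihilates-cong {c = c} x y (annihilates ann) x≗y =
    annihilates λ n → trans (sum-cong-≗ (λ t → cong (c t *_) (sym (x≗y _)))) (ann n)

  -- Coefficients are listed from d zero, the coefficient of x n; recurrent-recSum reverses them.
  Recurrent : (ℕ → ℚ) → Set
  Recurrent x = Σ ℕ λ l → Σ (Fin (suc l) → ℚ) λ d → (d zero ≢ 0ℚ) × (Σ ℕ λ n₀ → ∀ n → n₀ ≤ n →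
    x (n ℕ.+ suc l) + ∑[ j < suc l ] (d j * x (n ℕ.+ toℕ j)) ≡ 0ℚ)

  recurrent-suc : ∀ {x} → Recurrent (x ∘ suc) → Recurrent x
  recurrent-suc (l , d , d₀≢0 , n₀ , rec) = l , d , d₀≢0 , suc n₀ , λ { (suc n) (s≤s n₀≤n) → rec n n₀≤n }

  recurrent-zero : ∀ {x} → (∀ n → x n ≡ 0ℚ) → Recurrent x
  recurrent-zero x≡0 = 0 , (λ _ → 1ℚ) , 1≢0 , 0 , λ n _ → cong₂ (λ y z → y + (1ℚ * z + 0ℚ)) (x≡0 _) (x≡0 _)

  *-≡0-cancelˡ : ∀ {p q} → p ≢ 0ℚ → p * q ≡ 0ℚ → q ≡ 0ℚ
  *-≡0-cancelˡ {p} {q} p≢0 pq≡0 = decidable-stable (q ≟ 0ℚ) (λ q≢0 → *-≢0 p≢0 q≢0 pq≡0)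

  annihilates-tail : ∀ {K x} (c : Fin (suc K) → ℚ) → c zero ≡ 0ℚ → Annihilates c x → Annihilates (c ∘ suc) (x ∘ suc)
  annihilates-tail {K} {x} c c₀≡0 (annihilates ann) = annihilates vanishes
    where
    vanishes : ∀ n → ∑[ t < K ] (c (suc t) * x (suc (n ℕ.+ toℕ t))) ≡ 0ℚ
    vanishes n = begin
      ∑[ t < K ] (c (suc t) * x (suc (n ℕ.+ toℕ t)))
        ≡⟨ sum-cong-≗ (λ t → cong (λ m → c (suc t) * x m) (sym (ℕ.+-suc n (toℕ t)))) ⟩
      S
        ≡⟨ sym (+-identityˡ S) ⟩
      0ℚ + S
        ≡⟨ cong (_+ S) (sym (trans (cong (_* x (n ℕ.+ 0)) c₀≡0) (*-zeroˡ (x (n ℕ.+ 0))))) ⟩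
      c zero * x (n ℕ.+ 0) + S
        ≡⟨ ann n ⟩
      0ℚ ∎
      where
      S = ∑[ t < K ] (c (suc t) * x (n ℕ.+ suc (toℕ t)))

  annihilates-init : ∀ {K x} (c : Fin (suc K) → ℚ) → c (fromℕ K) ≡ 0ℚ → Annihilates c x → Annihilates (c ∘ inject₁) x
  annihilates-init {K} {x} c top≡0 (annihilates ann) = annihilates vanishes
    where
    vanishes : ∀ n → ∑[ j < K ] (c (inject₁ j) * x (n ℕ.+ toℕ j)) ≡ 0ℚ
    vanishes n = begin
      ∑[ j < K ] (c (inject₁ j) * x (n ℕ.+ toℕ j))
        ≡⟨ sum-cong-≗ (λ j → cong (λ m → c (inject₁ j) * x (n ℕ.+ m)) (sym (toℕ-inject₁ j))) ⟩
      R
        ≡⟨ sym (+-identityʳ R) ⟩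
      R + 0ℚ
        ≡⟨ cong (R +_) (sym (trans (cong (_* X) top≡0) (*-zeroˡ X))) ⟩
      R + c (fromℕ K) * X
        ≡⟨ sym (sum-init-last (λ t → c t * x (n ℕ.+ toℕ t))) ⟩
      ∑[ t < suc K ] (c t * x (n ℕ.+ toℕ t))
        ≡⟨ ann n ⟩
      0ℚ ∎
      where
      X = x (n ℕ.+ toℕ (fromℕ K))
      R = ∑[ j < K ] (c (inject₁ j) * x (n ℕ.+ toℕ (inject₁ j)))

  recurrent-monic : ∀ {l x} (c : Fin (suc (suc l)) → ℚ) → c zero ≢ 0ℚ → c (fromℕ (suc l)) ≢ 0ℚ →
    Annihilates c x → Recurrent x
  recurrent-monic {l} {x} c c₀≢0 top≢0 (annihilates ann) = l , d , *-≢0 (1/-≢0 top≢0) c₀≢0 , 0 , λ n _ → monic n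
    where
    A = c (fromℕ (suc l))
    instance _ = ≢-nonZero top≢0
    d : Fin (suc l) → ℚ
    d j = 1/ A * c (inject₁ j)

    monic : ∀ n → x (n ℕ.+ suc l) + ∑[ j < suc l ] (d j * x (n ℕ.+ toℕ j)) ≡ 0ℚ
    monic n = begin
      x (n ℕ.+ suc l) + ∑[ j < suc l ] (d j * x (n ℕ.+ toℕ j))
        ≡⟨ cong₂ _+_ (cong (λ m → x (n ℕ.+ m)) (sym (toℕ-fromℕ (suc l))))
                     (sum-cong-≗ (λ j → trans (*-assoc (1/ A) (c (inject₁ j)) (x (n ℕ.+ toℕ j)))
                       (cong (λ m → 1/ A * (c (inject₁ j) * x (n ℕ.+ m))) (sym (toℕ-inject₁ j))))) ⟩
      X + ∑[ j < suc l ] (1/ A * (c (inject₁ j) * x (n ℕ.+ toℕ (inject₁ j))))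
        ≡⟨ cong (X +_) (sym (*-distribˡ-sum (1/ A) (λ j → c (inject₁ j) * x (n ℕ.+ toℕ (inject₁ j))))) ⟩
      X + 1/ A * R
        ≡⟨ cong (_+ 1/ A * R) (sym (trans (cong (_* X) (*-inverseˡ A)) (*-identityˡ X))) ⟩
      1/ A * A * X + 1/ A * R
        ≡⟨ solve 4 (λ B A X R → B :* A :* X :+ B :* R := B :* (R :+ A :* X)) refl (1/ A) A X R ⟩
      1/ A * (R + A * X)
        ≡⟨ cong (1/ A *_) (trans (sym (sum-init-last (λ t → c t * x (n ℕ.+ toℕ t)))) (ann n)) ⟩
      1/ A * 0ℚ
        ≡⟨ *-zeroʳ (1/ A) ⟩
      0ℚ ∎
      where
      X = x (n ℕ.+ toℕ (fromℕ (suc l)))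
      R = ∑[ j < suc l ] (c (inject₁ j) * x (n ℕ.+ toℕ (inject₁ j)))

  recurrent-head : ∀ {K x} (c : Fin (suc K) → ℚ) → c zero ≢ 0ℚ → Annihilates c x → Recurrent x
  recurrent-head {zero} {x} c c₀≢0 (annihilates ann) = recurrent-zero λ n →
    subst (λ m → x m ≡ 0ℚ) (ℕ.+-identityʳ n) (*-≡0-cancelˡ c₀≢0 (trans (sym (+-identityʳ _)) (ann n)))
  recurrent-head {suc K} c c₀≢0 ann with c (fromℕ (suc K)) ≟ 0ℚ
  ... | yes top≡0 = recurrent-head (c ∘ inject₁) c₀≢0 (annihilates-init c top≡0 ann)
  ... | no top≢0 = recurrent-monic c c₀≢0 top≢0 ann

  recurrent : ∀ {K x} (c : Fin K → ℚ) → Nontrivial c → Annihilates c x → Recurrent x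
  recurrent c (zero , c₀≢0) ann = recurrent-head c c₀≢0 ann
  recurrent {x = x} c (suc t , cₜ≢0) ann with c zero ≟ 0ℚ
  ... | yes c₀≡0 = recurrent-suc {x} (recurrent (c ∘ suc) (t , cₜ≢0) (annihilates-tail c c₀≡0 ann))
  ... | no c₀≢0 = recurrent-head c c₀≢0 ann

  foldr-tabulate : ∀ {n} (f : Fin n → ℚ) → foldr _+_ 0ℚ (tabulate f) ≡ ∑[ i < n ] f i
  foldr-tabulate {zero} f = refl
  foldr-tabulate {suc n} f = cong (f zero +_) (foldr-tabulate (f ∘ suc))

  recSum-opposite : ∀ l (d : Fin (suc l) → ℚ) x n →
    recSum (suc l) (d ∘ opposite) x n ≡ ∑[ j < suc l ] (d j * x (n ℕ.+ toℕ j))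
  recSum-opposite l d x n = begin
    foldr _+_ 0ℚ (map f (allFin (suc l)))
      ≡⟨ cong (foldr _+_ 0ℚ) (map-tabulate (λ i → i) f) ⟩
    foldr _+_ 0ℚ (tabulate f)
      ≡⟨ foldr-tabulate f ⟩
    ∑[ i < suc l ] f i
      ≡⟨ sum-cong-≗ (λ i → cong (λ m → d (opposite i) * x m)
                          (trans (ℕ.+-∸-assoc n (toℕ<n i)) (cong (n ℕ.+_) (sym (opposite-prop i))))) ⟩
    ∑[ i < suc l ] (d (opposite i) * x (n ℕ.+ toℕ (opposite i)))
      ≡⟨ sym (∑-permute (λ j → d j * x (n ℕ.+ toℕ j)) reverse) ⟩
    ∑[ j < suc l ] (d j * x (n ℕ.+ toℕ j)) ∎
    where
    f : Fin (suc l) → ℚ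
    f i = d (opposite i) * x (n ℕ.+ suc l ℕ.∸ suc (toℕ i))

  opposite-fromℕ : ∀ l → opposite (fromℕ l) ≡ zero
  opposite-fromℕ zero = refl
  opposite-fromℕ (suc l) = cong inject₁ (opposite-fromℕ l)

  recurrent-recSum : ∀ {x} → Recurrent x → Σ ℕ λ l → Σ (Fin (suc l) → ℚ) λ c → (c (fromℕ l) ≢ 0ℚ) ×
    (Σ ℕ λ n₀ → ∀ n → n₀ ≤ n → x (n ℕ.+ suc l) + recSum (suc l) c x n ≡ 0ℚ)
  recurrent-recSum {x} (l , d , d₀≢0 , n₀ , rec) =
    l , d ∘ opposite , (λ e → d₀≢0 (trans (cong d (sym (opposite-fromℕ l))) e)) , n₀ ,
    λ n n₀≤n → trans (cong (x (n ℕ.+ suc l) +_) (recSum-opposite l d x n)) (rec n n₀≤n)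

module SternTransfer where
  open import Defs
  open import Data.Nat using (ℕ; zero; suc; _+_; _*_; _^_; _≤_; _<_; s≤s; z≤n)
  open import Data.Nat.Properties
    using (+-*-semiring; *-zeroʳ; +-identityʳ; +-suc; +-assoc; *-comm; *-distribʳ-+; *-distribˡ-+
          ; m≤m*n; <⇒≤; ≤-trans; ≤-refl)
  open import Data.Nat.DivMod using (_%_; _/_; m*n%n≡0; m*n/n≡m; [m+kn]%n≡m%n; +-distrib-/)
  open import Data.Nat.ListAction using (sum; product)
  open import Data.Nat.ListAction.Properties using (sum-++; product-++)
  open import Data.Fin using (Fin; zero; suc; toℕ; fromℕ<)
  open import Data.Fin.Properties using (toℕ<n; toℕ-fromℕ<)
  open import Data.List using (List; []; _∷_; _++_; map; replicate; applyUpTo; allFin; length; cartesianProductWith)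
  open import Data.List.Properties using (map-++; map-∘; map-cong)
  open import Data.List.Membership.Propositional using (_∈_)
  open import Data.List.Membership.Propositional.Properties using (∈-cartesianProductWith⁺; ∈-allFin)
  open import Data.List.Relation.Unary.Any using (here)
  open import Data.Vec using (Vec; []; _∷_; fromList)
  import Data.Vec as Vec
  open import Data.Rational using (ℚ)
  open import Data.Product using (Σ; _×_; _,_)
  open import Function using (_∘_)
  open import Relation.Binary.PropositionalEquality
  open ≡-Reasoning
  open import Algebra.Properties.Semiring.Sum +-*-semiring
    using (sum-syntax; sum-cong-≗; ∑-distrib-+; sum-replicate-zero)
  open RationalRecurrence using (Nontrivial; Annihilates; annihilator; annihilates-cong; Recurrent; recurrent)

  -- shiftedStern n k = ⟨n , k − 1⟩, which makes the zero entry ⟨n , −1⟩ available.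
  shiftedStern : ℕ → ℕ → ℕ
  shiftedStern n zero = 0
  shiftedStern n (suc k) = stern n k

  [k*2]%2≡0 : ∀ k → k * 2 % 2 ≡ 0
  [k*2]%2≡0 k = m*n%n≡0 k 2

  [1+k*2]%2≡1 : ∀ k → suc (k * 2) % 2 ≡ 1
  [1+k*2]%2≡1 k = [m+kn]%n≡m%n 1 k 2

  [1+k*2]/2≡k : ∀ k → suc (k * 2) / 2 ≡ k
  [1+k*2]/2≡k k = trans (+-distrib-/ 1 (k * 2) (subst (λ r → 1 + r < 2) (sym ([k*2]%2≡0 k)) ≤-refl)) (m*n/n≡m k 2)

  stern-even : ∀ n k → stern (suc n) (k * 2) ≡ sternEven n k
  stern-even n k rewrite [k*2]%2≡0 k = cong (sternEven n) (m*n/n≡m k 2)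

  stern-odd : ∀ n k → stern (suc n) (suc (k * 2)) ≡ stern n k
  stern-odd n k rewrite [1+k*2]%2≡1 k = cong (stern n) ([1+k*2]/2≡k k)

  shiftedStern-even : ∀ n k → shiftedStern (suc n) (k * 2) ≡ shiftedStern n k
  shiftedStern-even n zero = refl
  shiftedStern-even n (suc k) = stern-odd n k

  shiftedStern-odd : ∀ n k → shiftedStern (suc n) (suc (k * 2)) ≡ shiftedStern n k + shiftedStern n (suc k)
  shiftedStern-odd n zero = stern-even n 0
  shiftedStern-odd n (suc k) = stern-even n (suc k)

  data Parity : ℕ → Set where
    even : ∀ t → Parity (t * 2)
    odd : ∀ t → Parity (suc (t * 2))

  parity : ∀ j → Parity j
  parity zero = even 0
  parity (suc j) with parity j
  ... | even t = odd t
  ... | odd t = even (suc t)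

  sum-map-*ˡ : ∀ {A : Set} c (f : A → ℕ) xs → sum (map (λ x → c * f x) xs) ≡ c * sum (map f xs)
  sum-map-*ˡ c f [] = sym (*-zeroʳ c)
  sum-map-*ˡ c f (x ∷ xs) = trans (cong (c * f x +_) (sum-map-*ˡ c f xs)) (sym (*-distribˡ-+ c (f x) _))

  prodMap : ∀ {A : Set} {D} → (A → ℕ) → Vec A D → ℕ
  prodMap f [] = 1
  prodMap f (x ∷ v) = f x * prodMap f v

  module _ {A : Set} where

    prodMap-cong : ∀ {D} {f g : A → ℕ} → (∀ x → f x ≡ g x) → (v : Vec A D) → prodMap f v ≡ prodMap g v
    prodMap-cong f≗g [] = refl
    prodMap-cong f≗g (x ∷ v) = cong₂ _*_ (f≗g x) (prodMap-cong f≗g v)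

    prodMap-map : ∀ {B : Set} {D} (f : B → ℕ) (g : A → B) (v : Vec A D) → prodMap f (Vec.map g v) ≡ prodMap (f ∘ g) v
    prodMap-map f g [] = refl
    prodMap-map f g (x ∷ v) = cong (f (g x) *_) (prodMap-map f g v)

    prodMap-fromList : ∀ (f : A → ℕ) xs → prodMap f (fromList xs) ≡ product (map f xs)
    prodMap-fromList f [] = refl
    prodMap-fromList f (x ∷ xs) = cong (f x *_) (prodMap-fromList f xs)

    choices : ∀ {D} → Vec (List A) D → List (Vec A D)
    choices [] = [] ∷ []
    choices (xs ∷ xss) = cartesianProductWith _∷_ xs (choices xss)

    sum-prodMap-cartesianProduct : ∀ {D} (f : A → ℕ) xs (vs : List (Vec A D)) →
      sum (map (prodMap f) (cartesianProductWith _∷_ xs vs)) ≡ sum (map f xs) * sum (map (prodMap f) vs)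
    sum-prodMap-cartesianProduct f [] vs = refl
    sum-prodMap-cartesianProduct f (x ∷ xs) vs = begin
      sum (map P (map (x ∷_) vs ++ rest))
        ≡⟨ cong sum (map-++ P (map (x ∷_) vs) rest) ⟩
      sum (map P (map (x ∷_) vs) ++ map P rest)
        ≡⟨ sum-++ (map P (map (x ∷_) vs)) (map P rest) ⟩
      sum (map P (map (x ∷_) vs)) + sum (map P rest)
        ≡⟨ cong₂ _+_ (trans (cong sum (sym (map-∘ vs))) (sum-map-*ˡ (f x) P vs)) (sum-prodMap-cartesianProduct f xs vs) ⟩
      f x * sum (map P vs) + sum (map f xs) * sum (map P vs)
        ≡⟨ sym (*-distribʳ-+ (sum (map P vs)) (f x) _) ⟩
      (f x + sum (map f xs)) * sum (map P vs) ∎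
      where
      P : ∀ {D} → Vec A D → ℕ
      P = prodMap f
      rest = cartesianProductWith _∷_ xs vs

    prodMap-sum : ∀ {D} (f : A → ℕ) (xss : Vec (List A) D) →
      prodMap (λ xs → sum (map f xs)) xss ≡ sum (map (prodMap f) (choices xss))
    prodMap-sum f [] = refl
    prodMap-sum f (xs ∷ xss) =
      trans (cong (sum (map f xs) *_) (prodMap-sum f xss)) (sym (sum-prodMap-cartesianProduct f xs (choices xss)))

    ∈-choices-replicate : ∀ {xs} → (∀ x → x ∈ xs) → ∀ {D} (v : Vec A D) → v ∈ choices (Vec.replicate D xs)
    ∈-choices-replicate all [] = here refl
    ∈-choices-replicate all (x ∷ v) = ∈-cartesianProductWith⁺ _∷_ (all x) (∈-choices-replicate all v)

  sum-map-applyUpTo : ∀ (f g : ℕ → ℕ) N → sum (map f (applyUpTo g N)) ≡ ∑[ k < N ] f (g (toℕ k))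
  sum-map-applyUpTo f g zero = refl
  sum-map-applyUpTo f g (suc N) = cong (f (g 0) +_) (sum-map-applyUpTo f (g ∘ suc) N)

  ∑-split-parity : ∀ N (f : ℕ → ℕ) → ∑[ k < N * 2 ] f (toℕ k) ≡ ∑[ k < N ] (f (toℕ k * 2) + f (suc (toℕ k * 2)))
  ∑-split-parity zero f = refl
  ∑-split-parity (suc N) f = trans (sym (+-assoc (f 0) (f 1) _)) (cong (f 0 + f 1 +_) (∑-split-parity N (λ k → f (suc (suc k)))))

  ∑-sum-map-comm : ∀ {A : Set} N (g : A → Fin N → ℕ) xs →
    ∑[ k < N ] sum (map (λ x → g x k) xs) ≡ sum (map (λ x → ∑[ k < N ] g x k) xs)
  ∑-sum-map-comm N g [] = sum-replicate-zero N
  ∑-sum-map-comm N g (x ∷ xs) =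
    trans (∑-distrib-+ (g x) (λ k → sum (map (λ y → g y k) xs))) (cong (∑[ k < N ] g x k +_) (∑-sum-map-comm N g xs))

  module Window (a : ℕ → ℕ → ℕ)
    (a-even : ∀ n k → a (suc n) (k * 2) ≡ a n k)
    (a-odd : ∀ n k → a (suc n) (suc (k * 2)) ≡ a n k + a n (suc k))
    (w : ℕ) where

    Offset : Set
    Offset = Fin (suc (suc w))

    half< : ∀ t → t * 2 ≤ suc (suc w) → t < suc (suc w)
    half< zero _ = s≤s z≤n
    half< (suc t) (s≤s (s≤s t*2≤w)) = s≤s (s≤s (≤-trans (m≤m*n t 2) t*2≤w))

    suc-half< : ∀ t → suc (t * 2) ≤ suc (suc w) → suc t < suc (suc w)
    suc-half< zero _ = s≤s (s≤s z≤n)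
    suc-half< (suc t) (s≤s (s≤s 1+t*2≤w)) = s≤s (s≤s (≤-trans (s≤s (m≤m*n t 2)) 1+t*2≤w))

    halves : ∀ j → j ≤ suc (suc w) → List Offset
    halves j j≤ with parity j
    ... | even t = fromℕ< (half< t j≤) ∷ []
    ... | odd t = fromℕ< (<⇒≤ (suc-half< t j≤)) ∷ fromℕ< (suc-half< t j≤) ∷ []

    a-halves : ∀ n k j (j≤ : j ≤ suc (suc w)) →
      a (suc n) (k * 2 + j) ≡ sum (map (λ e → a n (k + toℕ e)) (halves j j≤))
    a-halves n k j j≤ with parity j
    ... | even t = begin
      a (suc n) (k * 2 + t * 2)        ≡⟨ cong (a (suc n)) (sym (*-distribʳ-+ 2 k t)) ⟩
      a (suc n) ((k + t) * 2)          ≡⟨ a-even n (k + t) ⟩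
      a n (k + t)                      ≡⟨ cong (λ e → a n (k + e)) (sym (toℕ-fromℕ< t<)) ⟩
      a n (k + toℕ (fromℕ< t<))        ≡⟨ sym (+-identityʳ _) ⟩
      a n (k + toℕ (fromℕ< t<)) + 0    ∎
      where t< = half< t j≤
    ... | odd t = begin
      a (suc n) (k * 2 + suc (t * 2))  ≡⟨ cong (a (suc n)) (trans (+-suc (k * 2) (t * 2)) (cong suc (sym (*-distribʳ-+ 2 k t)))) ⟩
      a (suc n) (suc ((k + t) * 2))    ≡⟨ a-odd n (k + t) ⟩
      a n (k + t) + a n (suc (k + t))  ≡⟨ cong₂ (λ e e′ → a n e + a n e′) (cong (k +_) (sym (toℕ-fromℕ< t<)))
                                                 (trans (sym (+-suc k t)) (cong (k +_) (sym (toℕ-fromℕ< 1+t<)))) ⟩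
      a n (k + toℕ (fromℕ< t<)) + a n (k + toℕ (fromℕ< 1+t<))
                                       ≡⟨ cong (a n (k + toℕ (fromℕ< t<)) +_) (sym (+-identityʳ _)) ⟩
      a n (k + toℕ (fromℕ< t<)) + (a n (k + toℕ (fromℕ< 1+t<)) + 0) ∎
      where
      1+t< = suc-half< t j≤
      t< = <⇒≤ 1+t<

    windows : ∀ D → List (Vec Offset D)
    windows D = choices (Vec.replicate D (allFin (suc (suc w))))

    ∈-windows : ∀ {D} (o : Vec Offset D) → o ∈ windows D
    ∈-windows = ∈-choices-replicate ∈-allFin

    evenChildren oddChildren : Offset → List Offset
    evenChildren e = halves (toℕ e) (<⇒≤ (toℕ<n e))
    oddChildren e = halves (suc (toℕ e)) (toℕ<n e)

    windowProduct : ∀ {D} → ℕ → Vec Offset D → ℕ → ℕ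
    windowProduct n o k = prodMap (λ e → a n (k + toℕ e)) o

    windowSum : ∀ {D} → ℕ → Vec Offset D → ℕ
    windowSum n o = ∑[ k < 2 ^ suc n ] windowProduct n o (toℕ k)

    successors : ∀ {D} → Vec Offset D → List (Vec Offset D)
    successors o = choices (Vec.map evenChildren o) ++ choices (Vec.map oddChildren o)

    windowProduct-children : ∀ {D} n k j (children : Offset → List Offset) →
      (∀ e → a (suc n) (k * 2 + (j + toℕ e)) ≡ sum (map (λ e′ → a n (k + toℕ e′)) (children e))) →
      (o : Vec Offset D) →
      windowProduct (suc n) o (k * 2 + j) ≡ sum (map (λ v → windowProduct n v k) (choices (Vec.map children o)))
    windowProduct-children n k j children split o = begin
      prodMap (λ e → a (suc n) (k * 2 + j + toℕ e)) o
        ≡⟨ prodMap-cong (λ e → trans (cong (a (suc n)) (+-assoc (k * 2) j (toℕ e))) (split e)) o ⟩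
      prodMap (λ e → sum (map f (children e))) o
        ≡⟨ sym (prodMap-map (λ xs → sum (map f xs)) children o) ⟩
      prodMap (λ xs → sum (map f xs)) (Vec.map children o)
        ≡⟨ prodMap-sum f (Vec.map children o) ⟩
      sum (map (prodMap f) (choices (Vec.map children o))) ∎
      where
      f : Offset → ℕ
      f e′ = a n (k + toℕ e′)

    windowSum-suc : ∀ {D} n (o : Vec Offset D) → windowSum (suc n) o ≡ sum (map (windowSum n) (successors o))
    windowSum-suc n o = begin
      ∑[ k < 2 ^ suc (suc n) ] P (suc n) o (toℕ k)
        ≡⟨ cong (λ N → ∑[ k < N ] P (suc n) o (toℕ k)) (*-comm 2 B) ⟩
      ∑[ k < B * 2 ] P (suc n) o (toℕ k)
        ≡⟨ ∑-split-parity B (P (suc n) o) ⟩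
      ∑[ k < B ] (P (suc n) o (toℕ k * 2) + P (suc n) o (suc (toℕ k * 2)))
        ≡⟨ sum-cong-≗ {B} (λ k → cong₂ _+_ (evenStep (toℕ k)) (oddStep (toℕ k))) ⟩
      ∑[ k < B ] (sum (map (λ v → P n v (toℕ k)) E) + sum (map (λ v → P n v (toℕ k)) O))
        ≡⟨ sum-cong-≗ {B} (λ k → trans (sym (sum-++ (map (λ v → P n v (toℕ k)) E) _))
                                       (cong sum (sym (map-++ (λ v → P n v (toℕ k)) E O)))) ⟩
      ∑[ k < B ] sum (map (λ v → P n v (toℕ k)) (successors o))
        ≡⟨ ∑-sum-map-comm B (λ v k → P n v (toℕ k)) (successors o) ⟩
      sum (map (windowSum n) (successors o)) ∎
      where
      P : ∀ {D} → ℕ → Vec Offset D → ℕ → ℕ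
      P = windowProduct
      B = 2 ^ suc n
      E = choices (Vec.map evenChildren o)
      O = choices (Vec.map oddChildren o)
      evenStep : ∀ k → P (suc n) o (k * 2) ≡ sum (map (λ v → P n v k) E)
      evenStep k = trans (cong (P (suc n) o) (sym (+-identityʳ (k * 2))))
        (windowProduct-children n k 0 evenChildren (λ e → a-halves n k (toℕ e) (<⇒≤ (toℕ<n e))) o)
      oddStep : ∀ k → P (suc n) o (suc (k * 2)) ≡ sum (map (λ v → P n v k) O)
      oddStep k = trans (cong (P (suc n) o) (sym (trans (+-suc (k * 2) 0) (cong suc (+-identityʳ (k * 2))))))
        (windowProduct-children n k 1 oddChildren (λ e → a-halves n k (suc (toℕ e)) (toℕ<n e)) o)

    windowSum-annihilated : ∀ D →
      Σ ℕ λ K → Σ (Fin K → ℚ) λ c → Nontrivial c ×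
        (∀ (o : Vec Offset D) → Annihilates c (λ n → toℚ (windowSum n o)))
    windowSum-annihilated D = annihilator (windows D) ∈-windows successors windowSum windowSum-suc

  -- The + 1 compensates the shift in shiftedStern.
  offsets : ∀ {m} → (Fin m → ℕ) → List (Fin m) → List (Fin (suc m))
  offsets α [] = []
  offsets α (i ∷ is) = replicate (α i) (suc i) ++ offsets α is

  product-map-replicate : ∀ {A : Set} (f : A → ℕ) k x → product (map f (replicate k x)) ≡ f x ^ k
  product-map-replicate f zero x = refl
  product-map-replicate f (suc k) x = cong (f x *_) (product-map-replicate f k x)

  product-map-offsets : ∀ {m} (α : Fin m → ℕ) (f : Fin (suc m) → ℕ) is →
    product (map f (offsets α is)) ≡ product (map (λ i → f (suc i) ^ α i) is)
  product-map-offsets α f [] = refl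
  product-map-offsets α f (i ∷ is) = begin
    product (map f (replicate (α i) (suc i) ++ offsets α is))
      ≡⟨ cong product (map-++ f (replicate (α i) (suc i)) _) ⟩
    product (map f (replicate (α i) (suc i)) ++ map f (offsets α is))
      ≡⟨ product-++ (map f (replicate (α i) (suc i))) _ ⟩
    product (map f (replicate (α i) (suc i))) * product (map f (offsets α is))
      ≡⟨ cong₂ _*_ (product-map-replicate f (α i) (suc i)) (product-map-offsets α f is) ⟩
    f (suc i) ^ α i * product (map (λ i → f (suc i) ^ α i) is) ∎

  module SternWindow (m : ℕ) = Window shiftedStern shiftedStern-even shiftedStern-odd m

  window : ∀ {m} (α : Fin (suc m) → ℕ) → Vec (Fin (suc (suc m))) (length (offsets α (allFin (suc m))))
  window α = fromList (offsets α (allFin _))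

  u≡windowSum : ∀ m (α : Fin (suc m) → ℕ) n → u (suc m) α n ≡ SternWindow.windowSum m n (window α)
  u≡windowSum m α n = trans (sum-map-applyUpTo (term (suc m) α n) (λ k → k) (2 ^ suc n))
                            (sum-cong-≗ {2 ^ suc n} (λ k → sym (term≡ (toℕ k))))
    where
    term≡ : ∀ k → SternWindow.windowProduct m n (window α) k ≡ term (suc m) α n k
    term≡ k = begin
      prodMap (λ e → shiftedStern n (k + toℕ e)) (fromList (offsets α (allFin (suc m))))
        ≡⟨ prodMap-fromList _ (offsets α (allFin (suc m))) ⟩
      product (map (λ e → shiftedStern n (k + toℕ e)) (offsets α (allFin (suc m))))
        ≡⟨ product-map-offsets α _ (allFin (suc m)) ⟩
      product (map (λ i → shiftedStern n (k + suc (toℕ i)) ^ α i) (allFin (suc m)))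
        ≡⟨ cong product (map-cong (λ i → cong (λ j → shiftedStern n j ^ α i) (+-suc k (toℕ i))) (allFin (suc m))) ⟩
      term (suc m) α n k ∎

  u-recurrent : ∀ m (α : Fin (suc m) → ℕ) → Recurrent (λ n → toℚ (u (suc m) α n))
  u-recurrent m α =
    let (_ , c , nontrivial , ann) = windowSum-annihilated (length (offsets α (allFin (suc m))))
    in recurrent c nontrivial (annihilates-cong _ _ (ann (window α)) (λ n → cong toℚ (sym (u≡windowSum m α n))))
    where open SternWindow m

open import Defs
open import Data.Nat using (ℕ; zero; suc; _+_; _≤_)
open import Data.Fin using (Fin; fromℕ)
open import Data.Product using (Σ; ∃; _×_)
open import Relation.Binary.PropositionalEquality using (_≡_; _≢_)
open import Data.Rational using (ℚ; 0ℚ) renaming (_+_ to _+ℚ_)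
open RationalRecurrence using (recurrent-recSum)
open SternTransfer using (u-recurrent)

theorem2p1 : (m : ℕ) → 1 ≤ m → (α : Fin m → ℕ) → (∃ λ i → α i ≢ 0) →
  Σ ℕ λ l → Σ (Fin (suc l) → ℚ) λ c → (c (fromℕ l) ≢ 0ℚ) × (Σ ℕ λ n₀ →
    ∀ n → n₀ ≤ n →
      toℚ (u m α (n + suc l)) +ℚ recSum (suc l) c (λ j → toℚ (u m α j)) n ≡ 0ℚ)
theorem2p1 zero () _ _
theorem2p1 (suc m) _ α _ = recurrent-recSum {x = λ j → toℚ (u (suc m) α j)} (u-recurrent m α)
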